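{- Let $G$ be a cubic graph. Then $|V(G)|=t(G)+\ell(G)$.
   Context: Graphs are finite and loopless but may have parallel edges (and may have bridges). A cubic graph is one in which every vertex has degree $3$. For a cubic graph $G$ and $U\subseteq V(G)$, $G_U$ denotes the cubic graph obtained from $G$ by expanding every vertex of $U$ into a triangle: a vertex $v$ with incident edges $e_1,e_2,e_3$ is replaced by three new mutually adjacent vertices $v_1,v_2,v_3$, with $e_i$ now incident to $v_i$ instead of $v$. $t(G)$ is the minimum size of a set $U\subseteq V(G)$ such that $G_U$ has a perfect matching. $\ell(G)$ is the maximum number of edges of a subgraph of $G$ in which every vertex has even degree (a largest even subgraph / longest cycle, where a cycle is a union of vertex-disjoint circuits). -}

module Defs where

open import Data.Nat using (ℕ; zero; suc; _+_; _*_; _≤_; _/_)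
open import Data.Nat.Divisibility using (_∣_)
open import Data.Fin using (Fin; zero; suc)
open import Data.Fin.Subset using (Subset; ∣_∣)
open import Data.Bool using (Bool; true; false)
open import Data.Vec using (lookup)
open import Data.Product using (Σ; ∃; ∃-syntax; _×_; _,_; proj₁)
open import Relation.Binary.PropositionalEquality using (_≡_; _≢_)

-- Cubic (multi)graphs in half-edge ("dart") form.
-- A vertex set V; each vertex v has exactly three darts (v , 0), (v , 1), (v , 2);
-- an edge is an unordered pair {d , σ d} of darts.  Parallel edges are allowed.
Dart : Set → Set
Dart V = V × Fin 3

Pairing : Set → Set
Pairing V = Dart V → Dart V

record Cubic (n : ℕ) : Set where
  field
    σ        : Pairing (Fin n)
    involut  : ∀ d → σ (σ d) ≡ d
    loopless : ∀ d → proj₁ (σ d) ≢ proj₁ d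
open Cubic public

-- Triangle expansion G_U
-- vertices of G_U: unexpanded vertices v ∉ U, and corners v_j (j ∈ Fin 3) for v ∈ U.
-- Convention: corner v_j carries the original edge e_j (dart j of v) at its dart 0,
-- and its two triangle edges at darts 1 and 2.

data ExpV {n : ℕ} (U : Subset n) : Set where
  plain  : (v : Fin n) → lookup U v ≡ false → ExpV U
  corner : (v : Fin n) → lookup U v ≡ true → Fin 3 → ExpV U

-- the dart of G_U at which the original edge-end (w , k) of G now sits
attach : {n : ℕ} (U : Subset n) → Dart (Fin n) → Dart (ExpV U)
attach U (w , k) with lookup U w in eq
... | false = (plain w eq , k)
... | true  = (corner w eq k , zero)

next prev : Fin 3 → Fin 3
next zero = suc zero
next (suc zero) = suc (suc zero)
next (suc (suc zero)) = zero
prev zero = suc (suc zero)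
prev (suc zero) = zero
prev (suc (suc zero)) = suc zero

expandPairing : {n : ℕ} → Pairing (Fin n) → (U : Subset n) → Pairing (ExpV U)
expandPairing σ U (plain v _ , i) = attach U (σ (v , i))
expandPairing σ U (corner v p j , zero) = attach U (σ (v , j))
expandPairing σ U (corner v p j , suc zero) = (corner v p (next j) , suc (suc zero))
expandPairing σ U (corner v p j , suc (suc zero)) = (corner v p (prev j) , suc zero)

expand : {n : ℕ} → Cubic n → (U : Subset n) → Pairing (ExpV U)
expand G U = expandPairing (σ G) U

-- Perfect matchings: a set M of edges (a σ-invariant set of darts) such that
-- every vertex is incident with exactly one edge of M.
HasPerfectMatching : {V : Set} → Pairing V → Set
HasPerfectMatching {V} τ =
  Σ (Dart V → Bool) λ M →
    (∀ d → M (τ d) ≡ M d) ×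
    (∀ v → ∃[ i ] (M (v , i) ≡ true × (∀ j → M (v , j) ≡ true → j ≡ i)))

IsT : {n : ℕ} → Cubic n → ℕ → Set
IsT {n} G k =
  (∃[ U ] (∣ U ∣ ≡ k × HasPerfectMatching (expand G U))) ×
  (∀ (U : Subset n) → HasPerfectMatching (expand G U) → k ≤ ∣ U ∣)

b2n : Bool → ℕ
b2n true = 1
b2n false = 0

sumFin : (n : ℕ) → (Fin n → ℕ) → ℕ
sumFin zero f = 0
sumFin (suc n) f = f zero + sumFin n (λ i → f (suc i))

degIn : {n : ℕ} → (Dart (Fin n) → Bool) → Fin n → ℕ
degIn S v = b2n (S (v , zero)) + b2n (S (v , suc zero)) + b2n (S (v , suc (suc zero)))

IsEvenSubgraph : {n : ℕ} → Cubic n → (Dart (Fin n) → Bool) → Set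
IsEvenSubgraph G S = (∀ d → S (σ G d) ≡ S d) × (∀ v → 2 ∣ degIn S v)

-- number of edges of S = (number of darts in S) / 2
edgeCount : {n : ℕ} → (Dart (Fin n) → Bool) → ℕ
edgeCount {n} S = sumFin n (degIn S) / 2

IsL : {n : ℕ} → Cubic n → ℕ → Set
IsL {n} G k =
  (∃[ S ] (IsEvenSubgraph G S × edgeCount S ≡ k)) ×
  (∀ S → IsEvenSubgraph G S → edgeCount S ≤ k)

{-# OPTIONS --safe #-}
-- An even subgraph S of a cubic graph has all degrees 0 or 2. Expanding exactly the set U
-- of its isolated vertices, the edges outside S form a perfect matching of G_U (each triangle
-- is matched through its three outer edges), and |U| + |S| = n because every other vertex
-- has degree 2. Conversely, the original edges left unmatched by a perfect matching of G_U
-- form an even subgraph in which every unexpanded vertex has degree 2, so n ≤ |U| + |S|.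
-- Applied to a longest even subgraph and to an optimal U, this gives n = t(G) + ℓ(G).
module Submission where

open import Defs
open import Data.Nat using (ℕ; _+_)
open import Data.Product using (∃-syntax; _×_)
open import Relation.Binary.PropositionalEquality using (_≡_)

open import Axiom.UniquenessOfIdentityProofs using (module Decidable⇒UIP)
open import Data.Bool using (Bool; true; false; not)
open import Data.Bool.Properties using (not-¬; ¬-not) renaming (_≟_ to _≟ᵇ_)
open import Data.Empty using (⊥-elim)
open import Data.Fin using (Fin; zero; suc)
open import Data.Fin.Properties using (all?)
open import Data.Fin.Subset using (Subset; ∣_∣)
open import Data.Fin.Subset.Properties using (anySubset?)
open import Data.Nat using (zero; suc; _*_; _≤_; _/_; _≡ᵇ_; z≤n; _≤?_)
open import Data.Nat.DivMod using (m*n/n≡m; /-monoˡ-≤)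
open import Data.Nat.Divisibility using (_∣_; _∤_; divides; _∣?_; >⇒∤; ∣m+n∣m⇒∣n; ∣-refl)
open import Data.Nat.Properties
  using (+-assoc; +-comm; +-suc; *-comm; *-zeroʳ; *-distribˡ-+; +-cancelʳ-≡; +-cancelʳ-≤; +-mono-≤; +-monoˡ-≤;
         +-monoʳ-≤; ≤-refl; ≤-reflexive; ≤-trans; ≤-antisym; ≤∧≢⇒<; m<1+n⇒m≤n; m≤n+m; module ≤-Reasoning)
open import Data.Nat.Tactic.RingSolver using (solve-∀)
open import Data.Product using (_,_; proj₁; proj₂)
open import Data.Sum using (_⊎_; inj₁; inj₂)
open import Data.Unit using (⊤; tt)
open import Data.Vec using ([]; _∷_; lookup; tabulate)
open import Data.Vec.Properties using (lookup∘tabulate)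
open import Function using (_∘_; _∋_)
open import Relation.Binary.PropositionalEquality using (refl; sym; trans; cong; cong₂; subst; _≢_; _≗_; module ≡-Reasoning)
open import Relation.Nullary using (yes; no)
open import Relation.Nullary.Decidable using (Dec; map′; _×-dec_)
open import Relation.Unary using (Decidable)

ExactlyOne : {A : Set} → (A → Bool) → Set
ExactlyOne h = ∃[ i ] (h i ≡ true × (∀ j → h j ≡ true → j ≡ i))

count₃ : (Fin 3 → Bool) → ℕ
count₃ h = b2n (h zero) + b2n (h (suc zero)) + b2n (h (suc (suc zero)))

count₃-cong : ∀ {h h′} → h ≗ h′ → count₃ h ≡ count₃ h′
count₃-cong eq = cong₂ _+_ (cong₂ _+_ (cong b2n (eq zero)) (cong b2n (eq (suc zero)))) (cong b2n (eq (suc (suc zero))))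

b2n-not : ∀ b → b2n (not b) + b2n b ≡ 1
b2n-not true = refl
b2n-not false = refl

count₃-not : ∀ h → count₃ (not ∘ h) + count₃ h ≡ 3
count₃-not h with h zero | h (suc zero) | h (suc (suc zero))
... | false | false | false = refl
... | false | false | true  = refl
... | false | true  | false = refl
... | false | true  | true  = refl
... | true  | false | false = refl
... | true  | false | true  = refl
... | true  | true  | false = refl
... | true  | true  | true  = refl

false-elsewhere : ∀ {A : Set} {h : A → Bool} {i} → (∀ j → h j ≡ true → j ≡ i) →
                  ∀ j → j ≢ i → h j ≡ false
false-elsewhere unique j j≢i = ¬-not (j≢i ∘ unique j)

exactlyOne⇒count₃≡1 : ∀ {h} → ExactlyOne h → count₃ h ≡ 1
exactlyOne⇒count₃≡1 (zero , hᵢ , unique)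
  rewrite hᵢ | false-elsewhere unique (suc zero) (λ ()) | false-elsewhere unique (suc (suc zero)) (λ ()) = refl
exactlyOne⇒count₃≡1 (suc zero , hᵢ , unique)
  rewrite hᵢ | false-elsewhere unique zero (λ ()) | false-elsewhere unique (suc (suc zero)) (λ ()) = refl
exactlyOne⇒count₃≡1 (suc (suc zero) , hᵢ , unique)
  rewrite hᵢ | false-elsewhere unique zero (λ ()) | false-elsewhere unique (suc zero) (λ ()) = refl

count₃≡1⇒exactlyOne : ∀ h → count₃ h ≡ 1 → ExactlyOne h
count₃≡1⇒exactlyOne h c with h zero in e₀ | h (suc zero) in e₁ | h (suc (suc zero)) in e₂
count₃≡1⇒exactlyOne h c | true | false | false =
  zero , e₀ , λ { zero _ → refl ; (suc zero) p → ⊥-elim (not-¬ e₁ p) ; (suc (suc zero)) p → ⊥-elim (not-¬ e₂ p) }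
count₃≡1⇒exactlyOne h c | false | true | false =
  suc zero , e₁ , λ { zero p → ⊥-elim (not-¬ e₀ p) ; (suc zero) _ → refl ; (suc (suc zero)) p → ⊥-elim (not-¬ e₂ p) }
count₃≡1⇒exactlyOne h c | false | false | true =
  suc (suc zero) , e₂ , λ { zero p → ⊥-elim (not-¬ e₀ p) ; (suc zero) p → ⊥-elim (not-¬ e₁ p) ; (suc (suc zero)) _ → refl }
count₃≡1⇒exactlyOne h () | true | true | _
count₃≡1⇒exactlyOne h () | true | false | true
count₃≡1⇒exactlyOne h () | false | true | true
count₃≡1⇒exactlyOne h () | false | false | false

count₃≡0⇒false : ∀ h → count₃ h ≡ 0 → ∀ j → h j ≡ false
count₃≡0⇒false h c with h zero in e₀ | h (suc zero) in e₁ | h (suc (suc zero)) in e₂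
count₃≡0⇒false h c | false | false | false = λ { zero → e₀ ; (suc zero) → e₁ ; (suc (suc zero)) → e₂ }
count₃≡0⇒false h () | true | _ | _
count₃≡0⇒false h () | false | true | _
count₃≡0⇒false h () | false | false | true

2∤1 : 2 ∤ 1
2∤1 = >⇒∤ ≤-refl

2∤3 : 2 ∤ 3
2∤3 2∣3 = 2∤1 (∣m+n∣m⇒∣n {m = 2} 2∣3 ∣-refl)

even-count₃ : ∀ h → 2 ∣ count₃ h → count₃ h ≡ 0 ⊎ count₃ h ≡ 2
even-count₃ h 2∣c with h zero | h (suc zero) | h (suc (suc zero))
... | false | false | false = inj₁ refl
... | false | true  | true  = inj₂ refl
... | true  | false | true  = inj₂ refl
... | true  | true  | false = inj₂ refl
... | false | false | true  = ⊥-elim (2∤1 2∣c)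
... | false | true  | false = ⊥-elim (2∤1 2∣c)
... | true  | false | false = ⊥-elim (2∤1 2∣c)
... | true  | true  | true  = ⊥-elim (2∤3 2∣c)

count₃≡2⇒exactlyOne-not : ∀ h → count₃ h ≡ 2 → ExactlyOne (not ∘ h)
count₃≡2⇒exactlyOne-not h c = count₃≡1⇒exactlyOne (not ∘ h)
  (+-cancelʳ-≡ 2 _ _ (trans (cong (count₃ (not ∘ h) +_) (sym c)) (count₃-not h)))

exactlyOne⇒count₃-not≡2 : ∀ {h} → ExactlyOne h → count₃ (not ∘ h) ≡ 2
exactlyOne⇒count₃-not≡2 {h} one =
  +-cancelʳ-≡ 1 _ _ (trans (cong (count₃ (not ∘ h) +_) (sym (exactlyOne⇒count₃≡1 one))) (count₃-not h))

exactlyOne⇒not₀ : ∀ {h} → ExactlyOne h → b2n (not (h zero)) ≡ b2n (h (suc zero)) + b2n (h (suc (suc zero)))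
exactlyOne⇒not₀ {h} one = +-cancelʳ-≡ (b2n (h zero)) _ _ (begin
  b2n (not (h zero)) + b2n (h zero)                      ≡⟨ b2n-not (h zero) ⟩
  1                                                      ≡⟨ exactlyOne⇒count₃≡1 one ⟨
  b2n (h zero) + b2n (h (suc zero)) + b2n (h (suc (suc zero)))
    ≡⟨ trans (+-assoc (b2n (h zero)) _ _) (+-comm (b2n (h zero)) _) ⟩
  b2n (h (suc zero)) + b2n (h (suc (suc zero))) + b2n (h zero) ∎)
  where open ≡-Reasoning

bool-irrelevant : {a b : Bool} (p q : a ≡ b) → p ≡ q
bool-irrelevant = Decidable⇒UIP.≡-irrelevant _≟ᵇ_

-- `attach` matches on `lookup U w` and stores the resulting proof, so a plain `with` on
-- `lookup U w` yields an ill-typed goal. Stating the eliminator for `F r` with `r : ⊤`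
-- separates the abstracted occurrence from the one in the proofs' types, which stays
-- `F tt`; η for ⊤ makes the two definitionally equal.
attach-elim′ : ∀ {n} (F : ⊤ → Subset n) r w k (P : Dart (ExpV (F tt)) → Set) →
               (∀ e → P (plain w e , k)) → (∀ e → P (corner w e k , zero)) →
               P (attach (F r) (w , k))
attach-elim′ F r w k P onPlain onCorner
  with lookup (F r) w | (lookup (F tt) w ≡ lookup (F r) w) ∋ refl
... | false | e = onPlain e
... | true  | e = onCorner e

attach-elim : ∀ {n} (U : Subset n) w k (P : Dart (ExpV U) → Set) →
              (∀ e → P (plain w e , k)) → (∀ e → P (corner w e k , zero)) →
              P (attach U (w , k))
attach-elim U = attach-elim′ (λ _ → U) tt

attach-plain : ∀ {n} {U : Subset n} {w} k (e : lookup U w ≡ false) → attach U (w , k) ≡ (plain w e , k)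
attach-plain {U = U} {w} k e = attach-elim U w k (_≡ (plain w e , k))
  (λ e′ → cong (λ e → plain w e , k) (bool-irrelevant e′ e))
  (λ e′ → ⊥-elim (not-¬ e e′))

attach-corner : ∀ {n} {U : Subset n} {w} k (e : lookup U w ≡ true) → attach U (w , k) ≡ (corner w e k , zero)
attach-corner {U = U} {w} k e = attach-elim U w k (_≡ (corner w e k , zero))
  (λ e′ → ⊥-elim (not-¬ e′ e))
  (λ e′ → cong (λ e → corner w e k , zero) (bool-irrelevant e′ e))

expand-attach : ∀ {n} (G : Cubic n) (U : Subset n) d → expand G U (attach U d) ≡ attach U (σ G d)
expand-attach G U (w , k) = attach-elim U w k (λ x → expand G U x ≡ attach U (σ G (w , k))) (λ _ → refl) (λ _ → refl)

sumFin-cong : ∀ n {f g : Fin n → ℕ} → f ≗ g → sumFin n f ≡ sumFin n g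
sumFin-cong zero    eq = refl
sumFin-cong (suc n) eq = cong₂ _+_ (eq zero) (sumFin-cong n (eq ∘ suc))

sumFin-mono : ∀ n {f g : Fin n → ℕ} → (∀ i → f i ≤ g i) → sumFin n f ≤ sumFin n g
sumFin-mono zero    le = z≤n
sumFin-mono (suc n) le = +-mono-≤ (le zero) (sumFin-mono n (le ∘ suc))

sumFin-*ˡ : ∀ n m (f : Fin n → ℕ) → sumFin n (λ i → m * f i) ≡ m * sumFin n f
sumFin-*ˡ zero    m f = sym (*-zeroʳ m)
sumFin-*ˡ (suc n) m f =
  trans (cong (m * f zero +_) (sumFin-*ˡ n m (f ∘ suc))) (sym (*-distribˡ-+ m (f zero) _))

∣U∣+∑∁U≡n : ∀ {n} (U : Subset n) → ∣ U ∣ + sumFin n (λ v → b2n (not (lookup U v))) ≡ n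
∣U∣+∑∁U≡n []          = refl
∣U∣+∑∁U≡n (true ∷ U)  = cong suc (∣U∣+∑∁U≡n U)
∣U∣+∑∁U≡n (false ∷ U) = trans (+-suc ∣ U ∣ _) (cong suc (∣U∣+∑∁U≡n U))

2*m/2≡m : ∀ m → 2 * m / 2 ≡ m
2*m/2≡m m = trans (cong (_/ 2) (*-comm 2 m)) (m*n/n≡m m 2)

edgeCount≡sumFin : ∀ {n} (S : Dart (Fin n) → Bool) (f : Fin n → ℕ) →
                   (∀ v → degIn S v ≡ 2 * f v) → edgeCount S ≡ sumFin n f
edgeCount≡sumFin {n} S f deg = begin
  sumFin n (degIn S) / 2             ≡⟨ cong (_/ 2) (sumFin-cong n deg) ⟩
  sumFin n (λ v → 2 * f v) / 2       ≡⟨ cong (_/ 2) (sumFin-*ˡ n 2 f) ⟩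
  2 * sumFin n f / 2                 ≡⟨ 2*m/2≡m (sumFin n f) ⟩
  sumFin n f                         ∎
  where open ≡-Reasoning

sumFin≤edgeCount : ∀ {n} (S : Dart (Fin n) → Bool) (f : Fin n → ℕ) →
                   (∀ v → 2 * f v ≤ degIn S v) → sumFin n f ≤ edgeCount S
sumFin≤edgeCount {n} S f deg = begin
  sumFin n f                         ≡⟨ 2*m/2≡m (sumFin n f) ⟨
  2 * sumFin n f / 2                 ≡⟨ cong (_/ 2) (sumFin-*ˡ n 2 f) ⟨
  sumFin n (λ v → 2 * f v) / 2       ≤⟨ /-monoˡ-≤ 2 (sumFin-mono n deg) ⟩
  sumFin n (degIn S) / 2             ∎
  where open ≤-Reasoning

module FromEvenSubgraph {n} (G : Cubic n) {S : Dart (Fin n) → Bool} (even : IsEvenSubgraph G S) where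

  isolated : Fin n → Bool
  isolated v = degIn S v ≡ᵇ 0

  U : Subset n
  U = tabulate isolated

  degIn≡2*[∉U] : ∀ v → degIn S v ≡ 2 * b2n (not (lookup U v))
  degIn≡2*[∉U] v rewrite lookup∘tabulate isolated v
    with degIn S v | even-count₃ (λ i → S (v , i)) (proj₂ even v)
  ... | _ | inj₁ refl = refl
  ... | _ | inj₂ refl = refl

  degIn-if : ∀ {v b} → lookup U v ≡ b → degIn S v ≡ 2 * b2n (not b)
  degIn-if {v} e = trans (degIn≡2*[∉U] v) (cong (λ b → 2 * b2n (not b)) e)

  matching : Dart (ExpV U) → Bool
  matching (plain v _ , i)         = not (S (v , i))
  matching (corner v _ j , zero)   = not (S (v , j))
  matching (corner v _ j , suc _)  = false

  matching-attach : ∀ d → matching (attach U d) ≡ not (S d)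
  matching-attach (w , k) = attach-elim U w k (λ x → matching x ≡ not (S (w , k))) (λ _ → refl) (λ _ → refl)

  matching-invariant : ∀ x → matching (expand G U x) ≡ matching x
  matching-invariant (plain v _ , i)              = trans (matching-attach (σ G (v , i))) (cong not (proj₁ even (v , i)))
  matching-invariant (corner v _ j , zero)        = trans (matching-attach (σ G (v , j))) (cong not (proj₁ even (v , j)))
  matching-invariant (corner v _ j , suc zero)       = refl
  matching-invariant (corner v _ j , suc (suc zero)) = refl

  matching-exactlyOne : ∀ x → ExactlyOne (λ i → matching (x , i))
  matching-exactlyOne (plain v e) = count₃≡2⇒exactlyOne-not (λ i → S (v , i)) (degIn-if e)
  matching-exactlyOne (corner v e j) =
    zero , cong not (count₃≡0⇒false (λ i → S (v , i)) (degIn-if e) j) , λ { zero _ → refl ; (suc _) () }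

  perfectMatching : HasPerfectMatching (expand G U)
  perfectMatching = matching , matching-invariant , matching-exactlyOne

  ∣U∣+edgeCount≡n : ∣ U ∣ + edgeCount S ≡ n
  ∣U∣+edgeCount≡n = trans (cong (∣ U ∣ +_) (edgeCount≡sumFin S _ degIn≡2*[∉U])) (∣U∣+∑∁U≡n U)

module FromPerfectMatching {n} (G : Cubic n) (U : Subset n) (M : Dart (ExpV U) → Bool)
  (M-invariant : ∀ x → M (expand G U x) ≡ M x) (M-exactlyOne : ∀ x → ExactlyOne (λ i → M (x , i))) where

  unmatched : Dart (Fin n) → Bool
  unmatched d = not (M (attach U d))

  unmatched-invariant : ∀ d → unmatched (σ G d) ≡ unmatched d
  unmatched-invariant d = cong not (trans (cong M (sym (expand-attach G U d))) (M-invariant (attach U d)))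

  degIn-outside : ∀ {v} → lookup U v ≡ false → degIn unmatched v ≡ 2
  degIn-outside {v} e = trans (count₃-cong (λ i → cong (not ∘ M) (attach-plain i e)))
                              (exactlyOne⇒count₃-not≡2 (M-exactlyOne (plain v e)))

  -- x j is the triangle edge from dart 1 of corner j to dart 2 of corner (next j). A corner's
  -- outer edge is unmatched iff one of its two triangle edges is matched, so summing over
  -- the corners counts every x j twice.
  degIn-inside-even : ∀ {v} → lookup U v ≡ true → 2 ∣ degIn unmatched v
  degIn-inside-even {v} e = divides (x zero + x (suc zero) + x (suc (suc zero))) (begin
      degIn unmatched v
        ≡⟨ cong₂ _+_ (cong₂ _+_ (corner-dart zero) (corner-dart (suc zero))) (corner-dart (suc (suc zero))) ⟩
      (x zero + x (suc (suc zero))) + (x (suc zero) + x zero) + (x (suc (suc zero)) + x (suc zero))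
        ≡⟨ triangle-sum (x zero) (x (suc zero)) (x (suc (suc zero))) ⟩
      (x zero + x (suc zero) + x (suc (suc zero))) * 2 ∎)
    where
    open ≡-Reasoning
    x : Fin 3 → ℕ
    x j = b2n (M (corner v e j , suc zero))

    triangle-sum : ∀ a b c → (a + c) + (b + a) + (c + b) ≡ (a + b + c) * 2
    triangle-sum = solve-∀

    next-prev : ∀ j → next (prev j) ≡ j
    next-prev zero = refl
    next-prev (suc zero) = refl
    next-prev (suc (suc zero)) = refl

    corner-dart : ∀ j → b2n (unmatched (v , j)) ≡ x j + x (prev j)
    corner-dart j = begin
      b2n (not (M (attach U (v , j))))                      ≡⟨ cong (b2n ∘ not ∘ M) (attach-corner j e) ⟩
      b2n (not (M (corner v e j , zero)))                   ≡⟨ exactlyOne⇒not₀ (M-exactlyOne (corner v e j)) ⟩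
      x j + b2n (M (corner v e j , suc (suc zero)))
        ≡⟨ cong (λ k → x j + b2n (M (corner v e k , suc (suc zero)))) (next-prev j) ⟨
      x j + b2n (M (corner v e (next (prev j)) , suc (suc zero)))
        ≡⟨ cong (λ b → x j + b2n b) (M-invariant (corner v e (prev j) , suc zero)) ⟩
      x j + x (prev j)                                      ∎

  degIn-even : ∀ v → 2 ∣ degIn unmatched v
  degIn-even v with lookup U v ≟ᵇ true
  ... | yes e = degIn-inside-even e
  ... | no ¬e = divides 1 (degIn-outside (¬-not ¬e))

  degIn≥2*[∉U] : ∀ v → 2 * b2n (not (lookup U v)) ≤ degIn unmatched v
  degIn≥2*[∉U] v with lookup U v ≟ᵇ true
  ... | yes e = subst (λ b → 2 * b2n (not b) ≤ degIn unmatched v) (sym e) z≤n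
  ... | no ¬e = subst (λ b → 2 * b2n (not b) ≤ degIn unmatched v) (sym (¬-not ¬e))
                      (≤-reflexive (sym (degIn-outside (¬-not ¬e))))

  evenSubgraph : IsEvenSubgraph G unmatched
  evenSubgraph = unmatched-invariant , degIn-even

  n≤∣U∣+edgeCount : n ≤ ∣ U ∣ + edgeCount unmatched
  n≤∣U∣+edgeCount = begin
    n                                                        ≡⟨ ∣U∣+∑∁U≡n U ⟨
    ∣ U ∣ + sumFin n (λ v → b2n (not (lookup U v)))          ≤⟨ +-monoʳ-≤ ∣ U ∣ (sumFin≤edgeCount unmatched _ degIn≥2*[∉U]) ⟩
    ∣ U ∣ + edgeCount unmatched                              ∎
    where open ≤-Reasoning

evenSubgraph⇒matchableExpansion : ∀ {n} (G : Cubic n) {S} → IsEvenSubgraph G S →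
  ∃[ U ] (HasPerfectMatching (expand G U) × ∣ U ∣ + edgeCount S ≡ n)
evenSubgraph⇒matchableExpansion G even = U , perfectMatching , ∣U∣+edgeCount≡n
  where open FromEvenSubgraph G even

matchableExpansion⇒evenSubgraph : ∀ {n} (G : Cubic n) {U} → HasPerfectMatching (expand G U) →
  ∃[ S ] (IsEvenSubgraph G S × n ≤ ∣ U ∣ + edgeCount S)
matchableExpansion⇒evenSubgraph G {U} (M , M-invariant , M-exactlyOne) =
  unmatched , evenSubgraph , n≤∣U∣+edgeCount
  where open FromPerfectMatching G U M M-invariant M-exactlyOne

greatest-≤ : {P : ℕ → Set} → Decidable P → P 0 → ∀ B → ∃[ k ] (P k × (∀ j → j ≤ B → P j → j ≤ k))
greatest-≤ P? p₀ zero = 0 , p₀ , λ { _ z≤n _ → z≤n }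
greatest-≤ P? p₀ (suc B) with P? (suc B) | greatest-≤ P? p₀ B
... | yes p  | _ = suc B , p , λ _ j≤1+B _ → j≤1+B
... | no ¬p | k , pk , maximal = k , pk , λ j j≤1+B pj →
  maximal j (m<1+n⇒m≤n (≤∧≢⇒< j≤1+B (λ { refl → ¬p pj }))) pj

any-dartSet? : ∀ {n} {Q : (Dart (Fin n) → Bool) → Set} →
               (∀ {S S′} → S ≗ S′ → Q S → Q S′) → Decidable Q → Dec (∃[ S ] Q S)
any-dartSet? {n} {Q} resp Q? = map′ to from
  (anySubset? λ s₀ → anySubset? λ s₁ → anySubset? λ s₂ → Q? (fromSubsets s₀ s₁ s₂))
  where
  fromSubsets : Subset n → Subset n → Subset n → Dart (Fin n) → Bool
  fromSubsets s₀ s₁ s₂ (v , zero)          = lookup s₀ v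
  fromSubsets s₀ s₁ s₂ (v , suc zero)      = lookup s₁ v
  fromSubsets s₀ s₁ s₂ (v , suc (suc zero)) = lookup s₂ v

  to : ∃[ s₀ ] ∃[ s₁ ] ∃[ s₂ ] Q (fromSubsets s₀ s₁ s₂) → ∃[ S ] Q S
  to (s₀ , s₁ , s₂ , q) = fromSubsets s₀ s₁ s₂ , q

  from : ∃[ S ] Q S → ∃[ s₀ ] ∃[ s₁ ] ∃[ s₂ ] Q (fromSubsets s₀ s₁ s₂)
  from (S , q) = tabulate (dart zero) , tabulate (dart (suc zero)) , tabulate (dart (suc (suc zero))) , resp tabulated q
    where
    dart : Fin 3 → Fin n → Bool
    dart i v = S (v , i)
    tabulated : S ≗ fromSubsets (tabulate (dart zero)) (tabulate (dart (suc zero))) (tabulate (dart (suc (suc zero))))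
    tabulated (v , zero)          = sym (lookup∘tabulate (dart zero) v)
    tabulated (v , suc zero)      = sym (lookup∘tabulate (dart (suc zero)) v)
    tabulated (v , suc (suc zero)) = sym (lookup∘tabulate (dart (suc (suc zero))) v)

module _ {n} (G : Cubic n) where

  isEvenSubgraph? : Decidable (IsEvenSubgraph G)
  isEvenSubgraph? S =
    map′ (λ inv d → inv (proj₁ d) (proj₂ d)) (λ inv v i → inv (v , i))
         (all? λ v → all? λ i → S (σ G (v , i)) ≟ᵇ S (v , i))
    ×-dec all? (λ v → 2 ∣? degIn S v)

  isEvenSubgraph-resp : ∀ {S S′} → S ≗ S′ → IsEvenSubgraph G S → IsEvenSubgraph G S′
  isEvenSubgraph-resp eq (inv , deg) =
    (λ d → trans (sym (eq (σ G d))) (trans (inv d) (eq d))) ,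
    (λ v → subst (2 ∣_) (count₃-cong (λ i → eq (v , i))) (deg v))

  edgeCount-cong : ∀ {S S′ : Dart (Fin n) → Bool} → S ≗ S′ → edgeCount S ≡ edgeCount S′
  edgeCount-cong eq = cong (_/ 2) (sumFin-cong n (λ v → count₃-cong (λ i → eq (v , i))))

  HasEvenSubgraphOfSize≥ : ℕ → Set
  HasEvenSubgraphOfSize≥ k = ∃[ S ] (IsEvenSubgraph G S × k ≤ edgeCount S)

  hasEvenSubgraphOfSize≥? : Decidable HasEvenSubgraphOfSize≥
  hasEvenSubgraphOfSize≥? k = any-dartSet?
    (λ eq (even , k≤) → isEvenSubgraph-resp eq even , subst (k ≤_) (edgeCount-cong eq) k≤)
    (λ S → isEvenSubgraph? S ×-dec (k ≤? edgeCount S))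

  edgeCount≤n : ∀ {S} → IsEvenSubgraph G S → edgeCount S ≤ n
  edgeCount≤n {S} even with evenSubgraph⇒matchableExpansion G even
  ... | U , _ , count = subst (edgeCount S ≤_) count (m≤n+m (edgeCount S) ∣ U ∣)

  emptyEvenSubgraph : IsEvenSubgraph G (λ _ → false)
  emptyEvenSubgraph = (λ _ → refl) , (λ _ → divides 0 refl)

  longestEvenSubgraph : ∃[ l ] IsL G l
  longestEvenSubgraph with greatest-≤ hasEvenSubgraphOfSize≥? ((λ _ → false) , emptyEvenSubgraph , z≤n) n
  ... | k , (S , even , k≤) , maximal = edgeCount S , (S , even , refl) , λ S′ even′ →
    ≤-trans (maximal (edgeCount S′) (edgeCount≤n even′) (S′ , even′ , ≤-refl)) k≤

  n≤∣U∣+ℓ : ∀ {l U} → IsL G l → HasPerfectMatching (expand G U) → n ≤ ∣ U ∣ + l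
  n≤∣U∣+ℓ {l} {U} (_ , longest) pm with matchableExpansion⇒evenSubgraph G pm
  ... | S , even , n≤ = ≤-trans n≤ (+-monoʳ-≤ ∣ U ∣ (longest S even))

  ∣U∣+ℓ≡n : ∀ {l} → IsL G l → ∃[ U ] (HasPerfectMatching (expand G U) × ∣ U ∣ + l ≡ n)
  ∣U∣+ℓ≡n ((S , even , refl) , _) = evenSubgraph⇒matchableExpansion G even

  optimalExpansion : ∀ {l} → IsL G l → ∃[ t ] IsT G t
  optimalExpansion {l} isL with ∣U∣+ℓ≡n isL
  ... | U , pm , count = ∣ U ∣ , (U , refl , pm) , λ U′ pm′ →
    +-cancelʳ-≤ l ∣ U ∣ ∣ U′ ∣ (subst (_≤ ∣ U′ ∣ + l) (sym count) (n≤∣U∣+ℓ isL pm′))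

  n≤t+ℓ : ∀ {t l} → IsT G t → IsL G l → n ≤ t + l
  n≤t+ℓ ((U , refl , pm) , _) isL = n≤∣U∣+ℓ isL pm

  t+ℓ≤n : ∀ {t l} → IsT G t → IsL G l → t + l ≤ n
  t+ℓ≤n {l = l} (_ , minimal) isL with ∣U∣+ℓ≡n isL
  ... | U , pm , count = subst (_ + l ≤_) count (+-monoˡ-≤ l (minimal U pm))

theorem4p1 : (n : ℕ) (G : Cubic n) →
    (∃[ t ] IsT G t) × (∃[ l ] IsL G l) ×
    (∀ t l → IsT G t → IsL G l → n ≡ t + l)
theorem4p1 n G =
  optimalExpansion G (proj₂ (longestEvenSubgraph G)) ,
  longestEvenSubgraph G ,
  λ _ _ isT isL → ≤-antisym (n≤t+ℓ G isT isL) (t+ℓ≤n G isT isL)
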